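{- For every hypergraph $\mathcal{H}$, $\gamma_{P_I}(\mathcal{H}) \le \gamma_P(\mathcal{H})$.
   Context: A hypergraph $\mathcal{H}=(V,E)$ consists of a finite vertex set $V$ and a set $E$ of nonempty subsets of $V$ (edges). Throughout, hypergraphs are reduced (no edge is contained in another distinct edge) and have at least one edge. For $a\in V$, the closed neighborhood is $N[a]=\bigcup_{a\in e\in E} e$ and $N(a)=N[a]\setminus\{a\}$; elements of $N(a)$ are neighbors of $a$. Power domination (Chang–Roussel): given $S_0\subseteq V$, first every vertex of $\bigcup_{v\in S_0}N[v]$ becomes observed; then repeatedly, if all unobserved neighbors of an observed vertex $v$ lie in one edge incident to $v$, these unobserved vertices become observed. $S_0$ is a power dominating set if eventually all vertices are observed; $\gamma_P(\mathcal{H})$ is the minimum size of a power dominating set. Infection rule: a nonempty set $A$ of infected vertices can infect the vertices of an edge $e$ if (1) $A\subseteq e$, and (2) every uninfected vertex $v$ such that $A\cup\{v\}$ is contained in some edge satisfies $v\in e$. Infectious power domination: given $S_0\subseteq V$, set $S=\bigcup_{v\in S_0}N[v]$ (the infected set); then, while there is a nonempty $A\subseteq S$ that can infect the vertices of an edge $e$ by the infection rule, add the vertices of $e$ to $S$. $S_0$ is an infectious power dominating set if $S=V$ at termination; $\gamma_{P_I}(\mathcal{H})$ is the minimum size of an infectious power dominating set. -}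

module Defs where

open import Level using (0ℓ)
open import Data.Nat using (ℕ; _≤_)
open import Data.Fin using (Fin)
open import Data.Fin.Subset using (Subset; _∈_; _∉_; _⊆_; Nonempty; ∣_∣)
open import Data.List using (List)
open import Data.List.Membership.Propositional using () renaming (_∈_ to _∈ₗ_)
open import Data.Product using (Σ; _×_; ∃; ∃-syntax; _,_)
open import Data.Sum using (_⊎_)
open import Relation.Nullary using (¬_)
open import Relation.Binary.PropositionalEquality using (_≡_; _≢_)

record Hypergraph : Set where
  field
    n        : ℕ
    edges    : List (Subset n)
    nonempty : ∀ {e} → e ∈ₗ edges → Nonempty e
    reduced  : ∀ {e f} → e ∈ₗ edges → f ∈ₗ edges → e ⊆ f → e ≡ f
    hasEdge  : edges ≢ Data.List.[]

module _ (H : Hypergraph) where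
  open Hypergraph H

  V : Set
  V = Fin n

  VSet : Set₁
  VSet = V → Set

  InClosedNbhd : V → V → Set
  InClosedNbhd a b = ∃[ e ] (e ∈ₗ edges × a ∈ e × b ∈ e)

  InNbhd : V → V → Set
  InNbhd a b = InClosedNbhd a b × b ≢ a

  initial : Subset n → VSet
  initial S₀ u = ∃[ v ] (v ∈ S₀ × InClosedNbhd v u)

  PDRule : VSet → V → Set
  PDRule S v = S v × ∃[ e ] (e ∈ₗ edges × v ∈ e ×
                 (∀ u → InNbhd v u → ¬ S u → u ∈ e))

  PDStep : VSet → V → VSet
  PDStep S v u = S u ⊎ (InNbhd v u × ¬ S u)

  data PDReachesAll : VSet → Set₁ where
    done : ∀ {S} → (∀ u → S u) → PDReachesAll S
    step : ∀ {S} v → PDRule S v → PDReachesAll (PDStep S v) → PDReachesAll S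

  IsPowerDominating : Subset n → Set₁
  IsPowerDominating S₀ = PDReachesAll (initial S₀)

  IsPowerDominationNumber : ℕ → Set₁
  IsPowerDominationNumber k =
    (∃[ S₀ ] (IsPowerDominating S₀ × ∣ S₀ ∣ ≡ k)) ×
    (∀ S₀ → IsPowerDominating S₀ → k ≤ ∣ S₀ ∣)

  CanInfect : VSet → Subset n → Subset n → Set
  CanInfect S A e =
    Nonempty A × (∀ u → u ∈ A → S u) × e ∈ₗ edges × A ⊆ e ×
    (∀ v → ¬ S v → (∃[ f ] (f ∈ₗ edges × A ⊆ f × v ∈ f)) → v ∈ e)

  InfStep : VSet → Subset n → VSet
  InfStep S e u = S u ⊎ u ∈ e

  data InfReachesAll : VSet → Set₁ where
    done : ∀ {S} → (∀ u → S u) → InfReachesAll S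
    step : ∀ {S} A e → CanInfect S A e → InfReachesAll (InfStep S e) → InfReachesAll S

  IsInfectiousPowerDominating : Subset n → Set₁
  IsInfectiousPowerDominating S₀ = InfReachesAll (initial S₀)

  IsInfectiousPowerDominationNumber : ℕ → Set₁
  IsInfectiousPowerDominationNumber k =
    (∃[ S₀ ] (IsInfectiousPowerDominating S₀ × ∣ S₀ ∣ ≡ k)) ×
    (∀ S₀ → IsInfectiousPowerDominating S₀ → k ≤ ∣ S₀ ∣)

module Submission where

-- Both processes start from the same set ⋃_{v ∈ S₀} N[v].  A power
-- domination step at an observed vertex v, whose unobserved neighbours all
-- lie in an edge e ∋ v, is simulated by the infection step with the
-- singleton A = {v} and the same edge e: every uninfected vertex sharing an
-- edge with v is an unobserved neighbour of v, hence lies in e.  Because the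
-- infection step adds all of e (a superset of what power domination adds),
-- the simulation is carried out against any infected set containing the
-- observed one.

open import Defs
open import Data.Nat using (ℕ; _≤_)
open import Data.Nat.Properties using (≤-trans; ≤-reflexive)
open import Data.Fin.Subset using (⁅_⁆; _∈_; _⊆_)
open import Data.Fin.Subset.Properties using (x∈⁅x⁆; x∈⁅y⁆⇒x≡y)
open import Data.List.Membership.Propositional using () renaming (_∈_ to _∈ₗ_)
open import Data.Product using (_×_; ∃-syntax; _,_)
open import Data.Sum using (inj₁; inj₂)
open import Relation.Nullary using (¬_)
open import Relation.Binary.PropositionalEquality using (subst; sym)

module _ (H : Hypergraph) where
  open Hypergraph H

  _⊆ᵥ_ : VSet H → VSet H → Set
  S ⊆ᵥ T = ∀ u → S u → T u

  -- If v is observed, S ⊆ T, and all S-unobserved neighbours of v lie in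
  -- the edge e ∋ v, then the singleton {v} can infect e with respect to T:
  -- a T-uninfected vertex w sharing an edge with v is an S-unobserved
  -- neighbour of v (w ≠ v since v ∈ T), hence w ∈ e.
  singleton-can-infect :
    ∀ {S T : VSet H} {v e} → S ⊆ᵥ T → S v → e ∈ₗ edges → v ∈ e →
    (∀ u → InNbhd H v u → ¬ S u → u ∈ e) → CanInfect H T ⁅ v ⁆ e
  singleton-can-infect {S} {T} {v} {e} S⊆T Sv e∈E v∈e nbrs⊆e =
    (v , x∈⁅x⁆ v) , singleton⊆T , e∈E , singleton⊆e , uninfected⊆e
    where
    Tv : T v
    Tv = S⊆T v Sv

    singleton⊆T : ∀ u → u ∈ ⁅ v ⁆ → T u
    singleton⊆T u u∈ = subst T (sym (x∈⁅y⁆⇒x≡y v u∈)) Tv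

    singleton⊆e : ⁅ v ⁆ ⊆ e
    singleton⊆e u∈ = subst (_∈ e) (sym (x∈⁅y⁆⇒x≡y v u∈)) v∈e

    uninfected⊆e : ∀ w → ¬ T w →
                   (∃[ f ] (f ∈ₗ edges × ⁅ v ⁆ ⊆ f × w ∈ f)) → w ∈ e
    uninfected⊆e w ¬Tw (f , f∈E , v⊆f , w∈f) =
      nbrs⊆e w w-neighbour (λ Sw → ¬Tw (S⊆T w Sw))
      where
      w-neighbour : InNbhd H v w
      w-neighbour = (f , f∈E , v⊆f (x∈⁅x⁆ v) , w∈f)
                  , λ w≡v → ¬Tw (subst T (sym w≡v) Tv)

  step-preserves-⊆ :
    ∀ {S T : VSet H} {v e} → S ⊆ᵥ T → (∀ u → InNbhd H v u → ¬ S u → u ∈ e) →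
    PDStep H S v ⊆ᵥ InfStep H T e
  step-preserves-⊆ S⊆T nbrs⊆e u (inj₁ Su)         = inj₁ (S⊆T u Su)
  step-preserves-⊆ S⊆T nbrs⊆e u (inj₂ (nb , ¬Su)) = inj₂ (nbrs⊆e u nb ¬Su)

  simulate : ∀ {S T : VSet H} → PDReachesAll H S → S ⊆ᵥ T → InfReachesAll H T
  simulate (done all-observed) S⊆T = done (λ u → S⊆T u (all-observed u))
  simulate (step v (Sv , e , e∈E , v∈e , nbrs⊆e) rest) S⊆T =
    step ⁅ v ⁆ e (singleton-can-infect S⊆T Sv e∈E v∈e nbrs⊆e)
         (simulate rest (step-preserves-⊆ S⊆T nbrs⊆e))

  power-dominating⇒infectious :
    ∀ S₀ → IsPowerDominating H S₀ → IsInfectiousPowerDominating H S₀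
  power-dominating⇒infectious S₀ pd = simulate pd (λ u initial-u → initial-u)

proposition3p3 : (H : Hypergraph) (k l : ℕ) → IsInfectiousPowerDominationNumber H l → IsPowerDominationNumber H k → l ≤ k
proposition3p3 H k l (_ , l-minimal) ((S₀ , S₀-pd , ∣S₀∣≡k) , _) =
  ≤-trans (l-minimal S₀ (power-dominating⇒infectious H S₀ S₀-pd)) (≤-reflexive ∣S₀∣≡k)
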